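{- Let $p$ be a prime with $p \equiv 1 \pmod 6$. Then $M_{p^k - 1} \equiv 2 \pmod p$ for every integer $k \geq 1$.
   Context: The Motzkin numbers are $M_n = \sum_{k \geq 0} \binom{n}{2k} C_k$, where $C_k = \frac{1}{k+1}\binom{2k}{k}$ are the Catalan numbers. -}

module Defs where

open import Data.Nat using (ℕ; zero; suc; _+_; _*_; _/_)
open import Data.Nat.Combinatorics using (_C_)

-- Catalan numbers: C_k = (1/(k+1)) * binom(2k, k)  (exact division)
catalan : ℕ → ℕ
catalan k = ((2 * k) C k) / suc k

sumTo : ℕ → (ℕ → ℕ) → ℕ
sumTo zero    f = f 0
sumTo (suc m) f = sumTo m f + f (suc m)

-- Motzkin numbers: M_n = Σ_{k ≥ 0} binom(n, 2k) C_k.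
-- Terms with 2k > n vanish, so summing k = 0..n covers all nonzero terms.
motzkin : ℕ → ℕ
motzkin n = sumTo n (λ k → (n C (2 * k)) * catalan k)

{-# OPTIONS --safe #-}
-- Write T(n, h) = trinomial n h for the coefficient of xʰ in (x⁻¹ + 1 + x)ⁿ. Expanding
-- (x⁻¹ + 1 + x)ⁿ = Σₘ C(n, m) (x⁻¹ + x)ᵐ and using C_k = C(2k, k) − C(2k, k + 1) gives
-- M_n = T(n, 0) − T(n, −2).
-- For q = pᵏ the derivative identity h T(q, h) = q (T(q − 1, h − 1) − T(q − 1, h + 1)) shows that
-- p divides T(q, h) whenever 0 < |h| < q. Hence T(q, h) = T(q − 1, h − 1) + T(q − 1, h) + T(q − 1, h + 1)
-- determines row q − 1 modulo p from its left end T(q − 1, 1 − q) = 1: read from there it is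
-- 1, −1, 0, 1, −1, 0, …, the coefficients of 1 / (1 + x + x²). As p ≡ 1 (mod 3), 3 divides q − 1,
-- so T(q − 1, 0) ≡ 1 and T(q − 1, −2) ≡ −1, whence M_{q−1} ≡ 2 (mod p).
module Submission where

open import Defs
open import Data.Nat.Primality using (Prime)
open import Data.Product using (∃-syntax; _×_; _,_; proj₁; proj₂)
open import Relation.Binary.PropositionalEquality
  using (_≡_; refl; sym; trans; cong; cong₂; subst; subst₂; module ≡-Reasoning)
open ≡-Reasoning

module _ where
  open import Data.Nat
  open import Data.Nat.Properties
  open import Data.Nat.Combinatorics using (_C_; nC1≡n; nCk+nC[k+1]≡[n+1]C[k+1])
  open import Data.Nat.DivMod using (m*n/n≡m)
  open import Data.Nat.Divisibility using (_∣_; divides; 1∣_; ∣-trans; m∣m*n; *-monoʳ-∣; *-cancelˡ-∣)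
  open import Data.Nat.Primality using (euclidsLemma; prime⇒nonZero)
  open import Data.Nat.Tactic.RingSolver using (solve-∀)
  open import Data.Sum using (inj₁; inj₂)
  open import Relation.Nullary using (¬_; contradiction)

  [1+k]*[1+n]C[1+k]≡[1+n]*nCk : ∀ n k → suc k * (suc n C suc k) ≡ suc n * (n C k)
  [1+k]*[1+n]C[1+k]≡[1+n]*nCk zero    zero    = refl
  [1+k]*[1+n]C[1+k]≡[1+n]*nCk zero    (suc k) = *-zeroʳ (suc (suc k))
  [1+k]*[1+n]C[1+k]≡[1+n]*nCk (suc n) zero    =
    trans (+-identityʳ _) (trans (nC1≡n (suc (suc n))) (sym (*-identityʳ (suc (suc n)))))
  [1+k]*[1+n]C[1+k]≡[1+n]*nCk (suc n) (suc k) = begin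
    suc (suc k) * (suc (suc n) C suc (suc k))
      ≡⟨ cong (suc (suc k) *_) (nCk+nC[k+1]≡[n+1]C[k+1] (suc n) (suc k)) ⟨
    suc (suc k) * (A + B)
      ≡⟨ regroup (suc k) A B ⟩
    (suc k * A + suc (suc k) * B) + A
      ≡⟨ cong (_+ A) (cong₂ _+_ ([1+k]*[1+n]C[1+k]≡[1+n]*nCk n k) ([1+k]*[1+n]C[1+k]≡[1+n]*nCk n (suc k))) ⟩
    (suc n * (n C k) + suc n * (n C suc k)) + A
      ≡⟨ cong (_+ A) (*-distribˡ-+ (suc n) (n C k) (n C suc k)) ⟨
    suc n * (n C k + n C suc k) + A
      ≡⟨ cong (λ x → suc n * x + A) (nCk+nC[k+1]≡[n+1]C[k+1] n k) ⟩
    suc n * A + A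
      ≡⟨ +-comm (suc n * A) A ⟩
    suc (suc n) * A ∎
    where
    A = suc n C suc k
    B = suc n C suc (suc k)
    regroup : ∀ a x y → suc a * (x + y) ≡ (a * x + suc a * y) + x
    regroup = solve-∀

  [1+k]*[2k]C[1+k]≡k*[2k]Ck : ∀ k → suc k * ((2 * k) C suc k) ≡ k * ((2 * k) C k)
  [1+k]*[2k]C[1+k]≡k*[2k]Ck k = +-cancelʳ-≡ _ _ _ (begin
    suc k * B′ + suc k * B   ≡⟨ *-distribˡ-+ (suc k) B′ B ⟨
    suc k * (B′ + B)         ≡⟨ cong (suc k *_) (+-comm B′ B) ⟩
    suc k * (B + B′)         ≡⟨ cong (suc k *_) (nCk+nC[k+1]≡[n+1]C[k+1] (2 * k) k) ⟩
    suc k * (suc (2 * k) C suc k) ≡⟨ [1+k]*[1+n]C[1+k]≡[1+n]*nCk (2 * k) k ⟩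
    suc (2 * k) * B          ≡⟨ split k B ⟩
    k * B + suc k * B        ∎)
    where
    B = (2 * k) C k
    B′ = (2 * k) C suc k
    split : ∀ k b → suc (2 * k) * b ≡ k * b + suc k * b
    split = solve-∀

  catalan+[2k]C[1+k]≡[2k]Ck : ∀ k → catalan k + (2 * k) C suc k ≡ (2 * k) C k
  catalan+[2k]C[1+k]≡[2k]Ck k = begin
    catalan k + B′           ≡⟨ cong (λ x → x / suc k + B′) (B∸B′*[1+k]≡B) ⟨
    (B ∸ B′) * suc k / suc k + B′ ≡⟨ cong (_+ B′) (m*n/n≡m (B ∸ B′) (suc k)) ⟩
    (B ∸ B′) + B′            ≡⟨ m∸n+n≡m B′≤B ⟩
    B                        ∎
    where
    B = (2 * k) C k
    B′ = (2 * k) C suc k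
    B′≤B : B′ ≤ B
    B′≤B = *-cancelˡ-≤ (suc k)
      (subst (_≤ suc k * B) (sym ([1+k]*[2k]C[1+k]≡k*[2k]Ck k)) (*-monoˡ-≤ B (n≤1+n k)))
    B∸B′*[1+k]≡B : (B ∸ B′) * suc k ≡ B
    B∸B′*[1+k]≡B = begin
      (B ∸ B′) * suc k         ≡⟨ *-distribʳ-∸ (suc k) B B′ ⟩
      B * suc k ∸ B′ * suc k   ≡⟨ cong₂ _∸_ (*-comm B (suc k)) (*-comm B′ (suc k)) ⟩
      B + k * B ∸ suc k * B′   ≡⟨ cong (B + k * B ∸_) ([1+k]*[2k]C[1+k]≡k*[2k]Ck k) ⟩
      B + k * B ∸ k * B        ≡⟨ m+n∸n≡m B (k * B) ⟩
      B                        ∎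

  sumTo-cong : ∀ n {f g : ℕ → ℕ} → (∀ m → f m ≡ g m) → sumTo n f ≡ sumTo n g
  sumTo-cong zero    f≡g = f≡g 0
  sumTo-cong (suc n) f≡g = cong₂ _+_ (sumTo-cong n f≡g) (f≡g (suc n))

  sumTo-+ : ∀ n (f g : ℕ → ℕ) → sumTo n (λ m → f m + g m) ≡ sumTo n f + sumTo n g
  sumTo-+ zero    f g = refl
  sumTo-+ (suc n) f g = trans (cong (_+ (f (suc n) + g (suc n))) (sumTo-+ n f g))
                              (+-+-comm (sumTo n f) (sumTo n g) (f (suc n)) (g (suc n)))
    where
    +-+-comm : ∀ a b c d → a + b + (c + d) ≡ a + c + (b + d)
    +-+-comm = solve-∀

  sumTo-suc : ∀ n (f : ℕ → ℕ) → sumTo (suc n) f ≡ f 0 + sumTo n (λ m → f (suc m))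
  sumTo-suc zero    f = refl
  sumTo-suc (suc n) f = trans (cong (_+ f (suc (suc n))) (sumTo-suc n f)) (+-assoc (f 0) _ _)

  sumTo-vanishing-tail : ∀ n d (f : ℕ → ℕ) → (∀ m → n < m → f m ≡ 0) → sumTo (d + n) f ≡ sumTo n f
  sumTo-vanishing-tail n zero    f f>n≡0 = refl
  sumTo-vanishing-tail n (suc d) f f>n≡0 =
    trans (cong₂ _+_ (sumTo-vanishing-tail n d f f>n≡0) (f>n≡0 (suc (d + n)) (s≤s (m≤n+m n d))))
          (+-identityʳ _)

  sumTo-pairs : ∀ n (f : ℕ → ℕ) → sumTo (suc (2 * n)) f ≡ sumTo n (λ k → f (2 * k) + f (suc (2 * k)))
  sumTo-pairs zero    f = refl
  sumTo-pairs (suc n) f = begin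
    sumTo (suc (2 * suc n)) f
      ≡⟨ cong (λ m → sumTo (suc m) f) (*-suc 2 n) ⟩
    sumTo (suc (2 * n)) f + f (suc (suc (2 * n))) + f (suc (suc (suc (2 * n))))
      ≡⟨ +-assoc (sumTo (suc (2 * n)) f) _ _ ⟩
    sumTo (suc (2 * n)) f + (f (suc (suc (2 * n))) + f (suc (suc (suc (2 * n)))))
      ≡⟨ cong₂ (λ s m → s + (f m + f (suc m))) (sumTo-pairs n f) (sym (*-suc 2 n)) ⟩
    sumTo (suc n) (λ k → f (2 * k) + f (suc (2 * k))) ∎

  sumTo-evens : ∀ n (f : ℕ → ℕ) → (∀ m → n < m → f m ≡ 0) → (∀ k → f (suc (2 * k)) ≡ 0) →
                sumTo n f ≡ sumTo n (λ k → f (2 * k))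
  sumTo-evens n f f>n≡0 f-odd≡0 = begin
    sumTo n f                  ≡⟨ sumTo-vanishing-tail n (suc n) f f>n≡0 ⟨
    sumTo (suc n + n) f        ≡⟨ cong (λ m → sumTo (suc m) f) (sym (2*n≡n+n n)) ⟩
    sumTo (suc (2 * n)) f      ≡⟨ sumTo-pairs n f ⟩
    sumTo n (λ k → f (2 * k) + f (suc (2 * k)))
      ≡⟨ sumTo-cong n (λ k → trans (cong (f (2 * k) +_) (f-odd≡0 k)) (+-identityʳ _)) ⟩
    sumTo n (λ k → f (2 * k)) ∎
    where
    2*n≡n+n : ∀ n → 2 * n ≡ n + n
    2*n≡n+n = solve-∀

  sumTo-pascal : ∀ n (g : ℕ → ℕ) →
                 sumTo (suc n) (λ m → (suc n C m) * g m)
                   ≡ sumTo (suc n) (λ m → (n C m) * g m) + sumTo n (λ m → (n C m) * g (suc m))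
  sumTo-pascal n g = begin
    sumTo (suc n) (λ m → (suc n C m) * g m)
      ≡⟨ sumTo-suc n (λ m → (suc n C m) * g m) ⟩
    1 * g 0 + sumTo n (λ m → (suc n C suc m) * g (suc m))
      ≡⟨ cong (1 * g 0 +_) (sumTo-cong n (λ m → cong (_* g (suc m)) (nCk+nC[k+1]≡[n+1]C[k+1] n m))) ⟨
    1 * g 0 + sumTo n (λ m → (n C m + n C suc m) * g (suc m))
      ≡⟨ cong (1 * g 0 +_) (sumTo-cong n (λ m → *-distribʳ-+ (g (suc m)) (n C m) (n C suc m))) ⟩
    1 * g 0 + sumTo n (λ m → (n C m) * g (suc m) + (n C suc m) * g (suc m))
      ≡⟨ cong (1 * g 0 +_) (sumTo-+ n _ _) ⟩
    1 * g 0 + (sumTo n (λ m → (n C m) * g (suc m)) + sumTo n (λ m → (n C suc m) * g (suc m)))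
      ≡⟨ x+[y+z]≡x+z+y (1 * g 0) _ _ ⟩
    1 * g 0 + sumTo n (λ m → (n C suc m) * g (suc m)) + sumTo n (λ m → (n C m) * g (suc m))
      ≡⟨ cong (_+ sumTo n (λ m → (n C m) * g (suc m))) (sumTo-suc n (λ m → (n C m) * g m)) ⟨
    sumTo (suc n) (λ m → (n C m) * g m) + sumTo n (λ m → (n C m) * g (suc m)) ∎
    where
    x+[y+z]≡x+z+y : ∀ x y z → x + (y + z) ≡ x + z + y
    x+[y+z]≡x+z+y = solve-∀

  [1+a*d]^k≡1+b*d : ∀ d a k → ∃[ b ] suc (a * d) ^ k ≡ suc (b * d)
  [1+a*d]^k≡1+b*d d a zero    = 0 , refl
  [1+a*d]^k≡1+b*d d a (suc k) with [1+a*d]^k≡1+b*d d a k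
  ... | b , eq = b + a * suc (b * d) , trans (cong (suc (a * d) *_) eq) (expand d a b)
    where
    expand : ∀ d a b → suc (a * d) * suc (b * d) ≡ suc ((b + a * suc (b * d)) * d)
    expand = solve-∀

  p^k∣m*n∧p∤n⇒p^k∣m : ∀ {p} → Prime p → ∀ k {m n} → p ^ k ∣ m * n → ¬ p ∣ n → p ^ k ∣ m
  p^k∣m*n∧p∤n⇒p^k∣m pr zero    {m}     _     p∤n = 1∣ m
  p^k∣m*n∧p∤n⇒p^k∣m {p} pr (suc k) {m} {n} p^k∣mn p∤n
    with euclidsLemma m n pr (∣-trans (m∣m*n (p ^ k)) p^k∣mn)
  ... | inj₂ p∣n = contradiction p∣n p∤n
  ... | inj₁ (divides m′ refl) =
    subst (p ^ suc k ∣_) (*-comm p m′) (*-monoʳ-∣ p (p^k∣m*n∧p∤n⇒p^k∣m pr k p^k∣m′n p∤n))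
    where
    instance _ = prime⇒nonZero pr
    p^k∣m′n : p ^ k ∣ m′ * n
    p^k∣m′n = *-cancelˡ-∣ p (subst (p * p ^ k ∣_)
      (trans (cong (_* n) (*-comm m′ p)) (*-assoc p m′ n)) p^k∣mn)

module _ where
  open import Data.Nat as ℕ using (ℕ; zero; suc)
  import Data.Nat.Properties as ℕ
  open import Data.Nat.Combinatorics using (_C_; nCk+nC[k+1]≡[n+1]C[k+1])
  open import Data.Integer using (ℤ; +_; -_; _+_; _-_; 0ℤ; 1ℤ)
  open import Data.Integer.Tactic.RingSolver using (solve-∀)

  δ₀ : ℤ → ℕ
  δ₀ (+ zero) = 1
  δ₀ _        = 0

  walks : ℕ → ℤ → ℕ
  walks zero    h = δ₀ h
  walks (suc m) h = walks m (h - 1ℤ) ℕ.+ walks m (h + 1ℤ)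

  trinomial : ℕ → ℤ → ℕ
  trinomial zero    h = δ₀ h
  trinomial (suc n) h = trinomial n (h - 1ℤ) ℕ.+ trinomial n h ℕ.+ trinomial n (h + 1ℤ)

  walks-beyond : ∀ m d → walks m (+ m + + suc d) ≡ 0
  walks-beyond zero    d = refl
  walks-beyond (suc m) d = cong₂ ℕ._+_
    (trans (cong (walks m) (down (+ m) (+ d))) (walks-beyond m d))
    (trans (cong (walks m) (up (+ m) (+ d))) (walks-beyond m (suc (suc d))))
    where
    down : ∀ x y → 1ℤ + x + (1ℤ + y) - 1ℤ ≡ x + (1ℤ + y)
    down = solve-∀
    up : ∀ x y → 1ℤ + x + (1ℤ + y) + 1ℤ ≡ x + (1ℤ + (1ℤ + (1ℤ + y)))
    up = solve-∀

  walks-even : ∀ m i → walks m (+ m - (+ i + + i)) ≡ m C i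
  walks-even zero    zero    = refl
  walks-even zero    (suc i) = refl
  walks-even (suc m) zero    = cong₂ ℕ._+_
    (trans (cong (walks m) (down (+ m))) (walks-even m zero))
    (trans (cong (walks m) (up (+ m))) (walks-beyond m 1))
    where
    down : ∀ x → 1ℤ + x - 0ℤ - 1ℤ ≡ x - 0ℤ
    down = solve-∀
    up : ∀ x → 1ℤ + x - 0ℤ + 1ℤ ≡ x + (1ℤ + 1ℤ)
    up = solve-∀
  walks-even (suc m) (suc i) = trans
    (cong₂ ℕ._+_ (trans (cong (walks m) (down (+ m) (+ i))) (walks-even m (suc i)))
                 (trans (cong (walks m) (up (+ m) (+ i))) (walks-even m i)))
    (trans (ℕ.+-comm (m C suc i) (m C i)) (nCk+nC[k+1]≡[n+1]C[k+1] m i))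
    where
    down : ∀ x y → 1ℤ + x - ((1ℤ + y) + (1ℤ + y)) - 1ℤ ≡ x - ((1ℤ + y) + (1ℤ + y))
    down = solve-∀
    up : ∀ x y → 1ℤ + x - ((1ℤ + y) + (1ℤ + y)) + 1ℤ ≡ x - (y + y)
    up = solve-∀

  walks-odd : ∀ m i → walks m (+ m - (1ℤ + (+ i + + i))) ≡ 0
  walks-odd zero    i       = refl
  walks-odd (suc m) zero    = cong₂ ℕ._+_
    (trans (cong (walks m) (down (+ m))) (walks-odd m zero))
    (trans (cong (walks m) (up (+ m))) (walks-beyond m 0))
    where
    down : ∀ x → 1ℤ + x - (1ℤ + 0ℤ) - 1ℤ ≡ x - (1ℤ + 0ℤ)
    down = solve-∀
    up : ∀ x → 1ℤ + x - (1ℤ + 0ℤ) + 1ℤ ≡ x + 1ℤ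
    up = solve-∀
  walks-odd (suc m) (suc i) = cong₂ ℕ._+_
    (trans (cong (walks m) (down (+ m) (+ i))) (walks-odd m (suc i)))
    (trans (cong (walks m) (up (+ m) (+ i))) (walks-odd m i))
    where
    down : ∀ x y → 1ℤ + x - (1ℤ + ((1ℤ + y) + (1ℤ + y))) - 1ℤ ≡ x - (1ℤ + ((1ℤ + y) + (1ℤ + y)))
    down = solve-∀
    up : ∀ x y → 1ℤ + x - (1ℤ + ((1ℤ + y) + (1ℤ + y))) + 1ℤ ≡ x - (1ℤ + (y + y))
    up = solve-∀

  walks[2k,-2j]≡[2k]C[j+k] : ∀ k j → walks (2 ℕ.* k) (- + (j ℕ.+ j)) ≡ (2 ℕ.* k) C (j ℕ.+ k)
  walks[2k,-2j]≡[2k]C[j+k] k j = trans (cong (walks (2 ℕ.* k)) index) (walks-even (2 ℕ.* k) (j ℕ.+ k))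
    where
    rebase : ∀ x y → - (y + y) ≡ x + x - ((y + x) + (y + x))
    rebase = solve-∀
    index : - + (j ℕ.+ j) ≡ + (2 ℕ.* k) - (+ (j ℕ.+ k) + + (j ℕ.+ k))
    index = trans (rebase (+ k) (+ j))
                  (cong (λ x → + (k ℕ.+ x) - (+ (j ℕ.+ k) + + (j ℕ.+ k))) (sym (ℕ.+-identityʳ k)))

  walks[1+2k,-2j]≡0 : ∀ k j → walks (suc (2 ℕ.* k)) (- + (j ℕ.+ j)) ≡ 0
  walks[1+2k,-2j]≡0 k j = trans (cong (walks (suc (2 ℕ.* k))) index) (walks-odd (suc (2 ℕ.* k)) (j ℕ.+ k))
    where
    rebase : ∀ x y → - (y + y) ≡ 1ℤ + (x + x) - (1ℤ + ((y + x) + (y + x)))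
    rebase = solve-∀
    index : - + (j ℕ.+ j) ≡ + suc (2 ℕ.* k) - (1ℤ + (+ (j ℕ.+ k) + + (j ℕ.+ k)))
    index = trans (rebase (+ k) (+ j))
                  (cong (λ x → + suc (k ℕ.+ x) - (1ℤ + (+ (j ℕ.+ k) + + (j ℕ.+ k)))) (sym (ℕ.+-identityʳ k)))

module _ where
  open import Data.Nat
  open import Data.Nat.Properties
  open import Data.Nat.Combinatorics using (_C_; k>n⇒nCk≡0)
  import Data.Integer as ℤ

  trinomial-as-sum : ∀ n h → trinomial n h ≡ sumTo n (λ m → (n C m) * walks m h)
  trinomial-as-sum zero    h = sym (+-identityʳ (δ₀ h))
  trinomial-as-sum (suc n) h = begin
    trinomial n h₋ + trinomial n h + trinomial n h₊
      ≡⟨ cong₂ _+_ (cong₂ _+_ (trinomial-as-sum n h₋) (trinomial-as-sum n h)) (trinomial-as-sum n h₊) ⟩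
    S h₋ + S h + S h₊
      ≡⟨ x+y+z≡y+[x+z] (S h₋) (S h) (S h₊) ⟩
    S h + (S h₋ + S h₊)
      ≡⟨ cong₂ _+_ (sumTo-vanishing-tail n 1 _ (λ m n<m → cong (_* walks m h) (k>n⇒nCk≡0 n<m)))
                   (sumTo-+ n _ _) ⟨
    sumTo (suc n) (λ m → (n C m) * walks m h) + sumTo n (λ m → (n C m) * walks m h₋ + (n C m) * walks m h₊)
      ≡⟨ cong (sumTo (suc n) (λ m → (n C m) * walks m h) +_)
              (sumTo-cong n (λ m → *-distribˡ-+ (n C m) (walks m h₋) (walks m h₊))) ⟨
    sumTo (suc n) (λ m → (n C m) * walks m h) + sumTo n (λ m → (n C m) * walks (suc m) h)
      ≡⟨ sumTo-pascal n (λ m → walks m h) ⟨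
    sumTo (suc n) (λ m → (suc n C m) * walks m h) ∎
    where
    h₋ = h ℤ.- ℤ.1ℤ
    h₊ = h ℤ.+ ℤ.1ℤ
    S : ℤ.ℤ → ℕ
    S h′ = sumTo n (λ m → (n C m) * walks m h′)
    x+y+z≡y+[x+z] : ∀ x y z → x + y + z ≡ y + (x + z)
    x+y+z≡y+[x+z] x y z = trans (cong (_+ z) (+-comm x y)) (+-assoc y x z)

  trinomial[n,-2j]-as-sum : ∀ n j → trinomial n (ℤ.- ℤ.+ (j + j)) ≡
                                   sumTo n (λ k → (n C (2 * k)) * ((2 * k) C (j + k)))
  trinomial[n,-2j]-as-sum n j = begin
    trinomial n h
      ≡⟨ trinomial-as-sum n h ⟩
    sumTo n (λ m → (n C m) * walks m h)
      ≡⟨ sumTo-evens n _ (λ m n<m → cong (_* walks m h) (k>n⇒nCk≡0 n<m))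
                         (λ k → trans (cong ((n C suc (2 * k)) *_) (walks[1+2k,-2j]≡0 k j)) (*-zeroʳ (n C suc (2 * k)))) ⟩
    sumTo n (λ k → (n C (2 * k)) * walks (2 * k) h)
      ≡⟨ sumTo-cong n (λ k → cong ((n C (2 * k)) *_) (walks[2k,-2j]≡[2k]C[j+k] k j)) ⟩
    sumTo n (λ k → (n C (2 * k)) * ((2 * k) C (j + k))) ∎
    where
    h = ℤ.- ℤ.+ (j + j)

  motzkin+trinomial[-2]≡trinomial[0] : ∀ n → motzkin n + trinomial n (ℤ.- ℤ.+ 2) ≡ trinomial n ℤ.0ℤ
  motzkin+trinomial[-2]≡trinomial[0] n = begin
    motzkin n + trinomial n (ℤ.- ℤ.+ 2)
      ≡⟨ cong (motzkin n +_) (trinomial[n,-2j]-as-sum n 1) ⟩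
    sumTo n (λ k → (n C (2 * k)) * catalan k) + sumTo n (λ k → (n C (2 * k)) * ((2 * k) C suc k))
      ≡⟨ sumTo-+ n _ _ ⟨
    sumTo n (λ k → (n C (2 * k)) * catalan k + (n C (2 * k)) * ((2 * k) C suc k))
      ≡⟨ sumTo-cong n (λ k → trans (sym (*-distribˡ-+ (n C (2 * k)) _ _))
                                (cong ((n C (2 * k)) *_) (catalan+[2k]C[1+k]≡[2k]Ck k))) ⟩
    sumTo n (λ k → (n C (2 * k)) * ((2 * k) C k))
      ≡⟨ trinomial[n,-2j]-as-sum n 0 ⟨
    trinomial n ℤ.0ℤ ∎

module _ where
  open import Data.Nat as ℕ using (ℕ; zero; suc)
  open import Data.Integer using (ℤ; +_; -_; _+_; _-_; _*_; 0ℤ; 1ℤ; -[1+_])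
  open import Data.Integer.Properties using (*-zeroʳ; +-identityʳ)
  open import Data.Integer.Tactic.RingSolver using (solve-∀)

  -- Coefficientwise form of x (d/dx) (x⁻¹ + 1 + x)ⁿ⁺¹ = (n + 1) (x − x⁻¹) (x⁻¹ + 1 + x)ⁿ.
  trinomial-deriv : ∀ n h → h * + trinomial (suc n) h
                             ≡ + suc n * (+ trinomial n (h - 1ℤ) - + trinomial n (h + 1ℤ))
  trinomial-deriv zero    (+ zero)        = refl
  trinomial-deriv zero    (+ suc zero)    = refl
  trinomial-deriv zero    (+ suc (suc k)) = *-zeroʳ (+ suc (suc k))
  trinomial-deriv zero    -[1+ zero ]     = refl
  trinomial-deriv zero    -[1+ suc k ]    = *-zeroʳ -[1+ suc k ]
  trinomial-deriv (suc n) h = begin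
    h * (X + Y + Z)
      ≡⟨ regroup h X Y Z ⟩
    (h - 1ℤ) * X + h * Y + (h + 1ℤ) * Z + (X - Z)
      ≡⟨ cong (_+ (X - Z)) (cong₂ _+_ (cong₂ _+_ X-deriv (trinomial-deriv n h)) Z-deriv) ⟩
    N * (a - c) + N * (b - d) + N * (c - e) + (X - Z)
      ≡⟨ telescope N a b c d e (X - Z) ⟩
    N * ((a + b + c) - (c + d + e)) + (X - Z)
      ≡⟨ cong (λ t → N * t + (X - Z)) (cong₂ _-_ X≡a+b+c Z≡c+d+e) ⟨
    N * (X - Z) + (X - Z)
      ≡⟨ factor N (X - Z) ⟩
    (1ℤ + N) * (X - Z) ∎
    where
    T : ℤ → ℤ
    T h′ = + trinomial n h′
    N = + suc n
    X = + trinomial (suc n) (h - 1ℤ)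
    Y = + trinomial (suc n) h
    Z = + trinomial (suc n) (h + 1ℤ)
    a = T (h - 1ℤ - 1ℤ)
    b = T (h - 1ℤ)
    c = T h
    d = T (h + 1ℤ)
    e = T (h + 1ℤ + 1ℤ)
    h-1+1≡h : ∀ h → h - 1ℤ + 1ℤ ≡ h
    h-1+1≡h = solve-∀
    h+1-1≡h : ∀ h → h + 1ℤ - 1ℤ ≡ h
    h+1-1≡h = solve-∀
    X≡a+b+c : X ≡ a + b + c
    X≡a+b+c = cong (λ t → a + b + T t) (h-1+1≡h h)
    Z≡c+d+e : Z ≡ c + d + e
    Z≡c+d+e = cong (λ t → T t + d + e) (h+1-1≡h h)
    X-deriv : (h - 1ℤ) * X ≡ N * (a - c)
    X-deriv = trans (trinomial-deriv n (h - 1ℤ)) (cong (λ t → N * (a - T t)) (h-1+1≡h h))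
    Z-deriv : (h + 1ℤ) * Z ≡ N * (c - e)
    Z-deriv = trans (trinomial-deriv n (h + 1ℤ)) (cong (λ t → N * (T t - e)) (h+1-1≡h h))
    regroup : ∀ h X Y Z → h * (X + Y + Z) ≡ (h - 1ℤ) * X + h * Y + (h + 1ℤ) * Z + (X - Z)
    regroup = solve-∀
    telescope : ∀ N a b c d e w → N * (a - c) + N * (b - d) + N * (c - e) + w
                                ≡ N * ((a + b + c) - (c + d + e)) + w
    telescope = solve-∀
    factor : ∀ N w → N * w + w ≡ (1ℤ + N) * w
    factor = solve-∀

  trinomial-below : ∀ n d → trinomial n (- + n - + suc d) ≡ 0
  trinomial-below zero    d = refl
  trinomial-below (suc n) d = cong₂ ℕ._+_
    (cong₂ ℕ._+_ (trans (cong (trinomial n) (shift₃ (+ n) (+ d))) (trinomial-below n (suc (suc d))))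
                 (trans (cong (trinomial n) (shift₂ (+ n) (+ d))) (trinomial-below n (suc d))))
    (trans (cong (trinomial n) (shift₁ (+ n) (+ d))) (trinomial-below n d))
    where
    shift₃ : ∀ x y → - (1ℤ + x) - (1ℤ + y) - 1ℤ ≡ - x - (1ℤ + (1ℤ + (1ℤ + y)))
    shift₃ = solve-∀
    shift₂ : ∀ x y → - (1ℤ + x) - (1ℤ + y) ≡ - x - (1ℤ + (1ℤ + y))
    shift₂ = solve-∀
    shift₁ : ∀ x y → - (1ℤ + x) - (1ℤ + y) + 1ℤ ≡ - x - (1ℤ + y)
    shift₁ = solve-∀

  trinomial-corner : ∀ n → trinomial n (- + n) ≡ 1
  trinomial-corner zero    = refl
  trinomial-corner (suc n) = cong₂ ℕ._+_
    (cong₂ ℕ._+_ (trans (cong (trinomial n) (shift₂ (+ n))) (trinomial-below n 1))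
                 (trans (cong (trinomial n) (shift₁ (+ n))) (trinomial-below n 0)))
    (trans (cong (trinomial n) (shift₀ (+ n))) (trinomial-corner n))
    where
    shift₂ : ∀ x → - (1ℤ + x) - 1ℤ ≡ - x - (1ℤ + 1ℤ)
    shift₂ = solve-∀
    shift₁ : ∀ x → - (1ℤ + x) ≡ - x - 1ℤ
    shift₁ = solve-∀
    shift₀ : ∀ x → - (1ℤ + x) + 1ℤ ≡ - x
    shift₀ = solve-∀

  row : ℕ → ℕ → ℕ
  row n i = trinomial n (- + n + + i)

  row[0]≡1 : ∀ n → row n 0 ≡ 1
  row[0]≡1 n = trans (cong (trinomial n) (+-identityʳ (- + n))) (trinomial-corner n)

  row-suc[1] : ∀ n → row (suc n) 1 ≡ row n 0 ℕ.+ row n 1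
  row-suc[1] n = cong₂ ℕ._+_
    (cong₂ ℕ._+_ (trans (cong (trinomial n) (shift₋₁ (+ n))) (trinomial-below n 0))
                 (cong (trinomial n) (shift₀ (+ n))))
    (cong (trinomial n) (shift₁ (+ n)))
    where
    shift₋₁ : ∀ x → - (1ℤ + x) + 1ℤ - 1ℤ ≡ - x - 1ℤ
    shift₋₁ = solve-∀
    shift₀ : ∀ x → - (1ℤ + x) + 1ℤ ≡ - x + 0ℤ
    shift₀ = solve-∀
    shift₁ : ∀ x → - (1ℤ + x) + 1ℤ + 1ℤ ≡ - x + 1ℤ
    shift₁ = solve-∀

  row-suc[2+i] : ∀ n i → row (suc n) (suc (suc i)) ≡ row n i ℕ.+ row n (suc i) ℕ.+ row n (suc (suc i))
  row-suc[2+i] n i = cong₂ ℕ._+_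
    (cong₂ ℕ._+_ (cong (trinomial n) (shift₀ (+ n) (+ i))) (cong (trinomial n) (shift₁ (+ n) (+ i))))
    (cong (trinomial n) (shift₂ (+ n) (+ i)))
    where
    shift₀ : ∀ x y → - (1ℤ + x) + (1ℤ + (1ℤ + y)) - 1ℤ ≡ - x + y
    shift₀ = solve-∀
    shift₁ : ∀ x y → - (1ℤ + x) + (1ℤ + (1ℤ + y)) ≡ - x + (1ℤ + y)
    shift₁ = solve-∀
    shift₂ : ∀ x y → - (1ℤ + x) + (1ℤ + (1ℤ + y)) + 1ℤ ≡ - x + (1ℤ + (1ℤ + y))
    shift₂ = solve-∀

module _ where
  open import Data.Nat using (suc; _*_; _<_; _≤_; _^_; _∸_; s≤s)
  open import Data.Nat.Properties using (<⇒≱; m<n⇒0<n∸m; ∸-monoʳ-<; m≤n⇒m≤1+n; *-comm)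
  open import Data.Nat.Divisibility using (_∣_; _∣?_; divides; ∣⇒≤)
  open import Data.Integer as ℤ using (+_; -_; ∣_∣)
  open import Data.Integer.Properties using (abs-*; ∣-i∣≡∣i∣; -m+n≡n⊖m; ⊖-<)
  open import Relation.Nullary using (yes; no; contradiction)

  p∣trinomial[p^k] : ∀ {p n} k → Prime p → suc n ≡ p ^ k →
                     ∀ j → 0 < j → j < suc n → p ∣ trinomial (suc n) (- + j)
  p∣trinomial[p^k] {p} {n} k pr q≡p^k j@(suc _) _ j<q with p ∣? trinomial (suc n) (- + j)
  ... | yes p∣T = p∣T
  ... | no  p∤T = contradiction (∣⇒≤ p^k∣j) (<⇒≱ (subst (j <_) q≡p^k j<q))
    where
    T = trinomial (suc n) (- + j)
    Y = + trinomial n (- + j ℤ.- ℤ.1ℤ) ℤ.- + trinomial n (- + j ℤ.+ ℤ.1ℤ)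
    j*T≡∣Y∣*q : j * T ≡ ∣ Y ∣ * suc n
    j*T≡∣Y∣*q = begin
      j * T                 ≡⟨ cong (_* T) (∣-i∣≡∣i∣ (+ j)) ⟨
      ∣ - + j ∣ * T         ≡⟨ abs-* (- + j) (+ T) ⟨
      ∣ - + j ℤ.* + T ∣     ≡⟨ cong ∣_∣ (trinomial-deriv n (- + j)) ⟩
      ∣ + suc n ℤ.* Y ∣     ≡⟨ abs-* (+ suc n) Y ⟩
      suc n * ∣ Y ∣         ≡⟨ *-comm (suc n) ∣ Y ∣ ⟩
      ∣ Y ∣ * suc n         ∎
    p^k∣j : p ^ k ∣ j
    p^k∣j = p^k∣m*n∧p∤n⇒p^k∣m pr k (subst (_∣ j * T) q≡p^k (divides ∣ Y ∣ j*T≡∣Y∣*q)) p∤T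

  p∣row[p^k] : ∀ {p n} k → Prime p → suc n ≡ p ^ k → ∀ i → 0 < i → i ≤ n → p ∣ row (suc n) i
  p∣row[p^k] {p} {n} k pr q≡p^k i 0<i i≤n =
    subst (p ∣_) (cong (trinomial (suc n)) (sym index))
      (p∣trinomial[p^k] k pr q≡p^k (suc n ∸ i) (m<n⇒0<n∸m (s≤s i≤n)) (∸-monoʳ-< 0<i (m≤n⇒m≤1+n i≤n)))
    where
    index : - + suc n ℤ.+ + i ≡ - + (suc n ∸ i)
    index = trans (-m+n≡n⊖m (suc n) i) (⊖-< (s≤s i≤n))

module _ where
  open import Data.Nat as ℕ using (ℕ; zero; suc; _<_; _≤_; _^_; s≤s; z≤n)
  open import Data.Nat.Properties using (<⇒≤; ≤-refl; m≤n+m)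
  open import Data.Nat.Divisibility using () renaming (_∣_ to _∣ℕ_)
  open import Data.Integer using (ℤ; +_; -_; _+_; _-_; 0ℤ; 1ℤ; -1ℤ)
  open import Data.Integer.Properties using (+-identityʳ; +-inverseˡ)
  open import Data.Integer.Divisibility.Signed using (_∣_; ∣ᵤ⇒∣; ∣m∣n⇒∣m-n; divides)
  open import Data.Integer.Tactic.RingSolver using (solve-∀)

  infix 4 _≡_mod_
  _≡_mod_ : ℤ → ℤ → ℕ → Set
  a ≡ b mod p = + p ∣ a - b

  ≡-mod-third : ∀ {p} a b c x y z → + p ∣ a + b + c → a ≡ x mod p → b ≡ y mod p →
                 x + y + z ≡ 0ℤ → c ≡ z mod p
  ≡-mod-third {p} a b c x y z p∣a+b+c a≡x b≡y x+y+z≡0 =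
    subst (+ p ∣_) difference (∣m∣n⇒∣m-n (∣m∣n⇒∣m-n p∣a+b+c a≡x) b≡y)
    where
    rearrange : ∀ a b c x y z → a + b + c - (a - x) - (b - y) ≡ c - z + (x + y + z)
    rearrange = solve-∀
    difference : a + b + c - (a - x) - (b - y) ≡ c - z
    difference = trans (rearrange a b c x y z) (trans (cong (_+_ (c - z)) x+y+z≡0) (+-identityʳ (c - z)))

  -- 1 / (1 + x + x²) = (1 − x) / (1 − x³) = Σᵢ recipCoeff i xⁱ.
  recipCoeff : ℕ → ℤ
  recipCoeff 0                   = 1ℤ
  recipCoeff 1                   = -1ℤ
  recipCoeff 2                   = 0ℤ
  recipCoeff (suc (suc (suc i))) = recipCoeff i

  recipCoeff-sum : ∀ i → recipCoeff i + recipCoeff (suc i) + recipCoeff (suc (suc i)) ≡ 0ℤ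
  recipCoeff-sum 0                   = refl
  recipCoeff-sum 1                   = refl
  recipCoeff-sum 2                   = refl
  recipCoeff-sum (suc (suc (suc i))) = recipCoeff-sum i

  recipCoeff[3m] : ∀ m → recipCoeff (m ℕ.* 3) ≡ 1ℤ
  recipCoeff[3m] zero    = refl
  recipCoeff[3m] (suc m) = recipCoeff[3m] m

  recipCoeff[3m+1] : ∀ m → recipCoeff (suc (m ℕ.* 3)) ≡ -1ℤ
  recipCoeff[3m+1] zero    = refl
  recipCoeff[3m+1] (suc m) = recipCoeff[3m+1] m

  row≡recipCoeff-mod : ∀ {p n} → (∀ i → 0 < i → i ≤ n → p ∣ℕ row (suc n) i) →
                        ∀ i → i ≤ n → + row n i ≡ recipCoeff i mod p
  row≡recipCoeff-mod {p} {n} p∣row[1+n] = λ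
    { zero    _   → row[0]≡1-mod
    ; (suc i) i<n → proj₂ (consecutive i i<n) }
    where
    row[0]≡1-mod : + row n 0 ≡ 1ℤ mod p
    row[0]≡1-mod = subst (λ r → + r ≡ 1ℤ mod p) (sym (row[0]≡1 n)) (divides 0ℤ refl)
    consecutive : ∀ i → suc i ≤ n →
                  (+ row n i ≡ recipCoeff i mod p) × (+ row n (suc i) ≡ recipCoeff (suc i) mod p)
    consecutive zero 1≤n = row[0]≡1-mod ,
      ≡-mod-third 0ℤ (+ row n 0) (+ row n 1) 0ℤ 1ℤ -1ℤ
        (∣ᵤ⇒∣ (subst (p ∣ℕ_) (row-suc[1] n) (p∣row[1+n] 1 (s≤s z≤n) 1≤n)))
        (divides 0ℤ refl) row[0]≡1-mod refl
    consecutive (suc i) 2+i≤n = proj₂ previous ,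
      ≡-mod-third (+ row n i) (+ row n (suc i)) (+ row n (suc (suc i)))
                  (recipCoeff i) (recipCoeff (suc i)) (recipCoeff (suc (suc i)))
        (∣ᵤ⇒∣ (subst (p ∣ℕ_) (row-suc[2+i] n i) (p∣row[1+n] (suc (suc i)) (s≤s z≤n) 2+i≤n)))
        (proj₁ previous) (proj₂ previous) (recipCoeff-sum i)
      where
      previous = consecutive i (<⇒≤ 2+i≤n)

  motzkin≡2-mod : ∀ {p} k m → Prime p → suc (suc m ℕ.* 3) ≡ p ^ k → + motzkin (suc m ℕ.* 3) ≡ + 2 mod p
  motzkin≡2-mod {p} k m pr q≡p^k = subst (+ p ∣_) rearrange (∣m∣n⇒∣m-n T[0]≡1 T[-2]≡-1)
    where
    n = suc m ℕ.* 3
    rows : ∀ i → i ≤ n → + row n i ≡ recipCoeff i mod p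
    rows = row≡recipCoeff-mod (p∣row[p^k] k pr q≡p^k)
    T[0]≡1 : + trinomial n 0ℤ ≡ 1ℤ mod p
    T[0]≡1 = subst₂ (λ h r → + trinomial n h ≡ r mod p) (+-inverseˡ (+ n)) (recipCoeff[3m] (suc m))
                    (rows n ≤-refl)
    index : ∀ x → - (1ℤ + (1ℤ + (1ℤ + x))) + (1ℤ + x) ≡ - (1ℤ + 1ℤ)
    index = solve-∀
    T[-2]≡-1 : + trinomial n (- + 2) ≡ -1ℤ mod p
    T[-2]≡-1 = subst₂ (λ h r → + trinomial n h ≡ r mod p) (index (+ (m ℕ.* 3))) (recipCoeff[3m+1] m)
                      (rows (suc (m ℕ.* 3)) (m≤n+m _ 2))
    motzkin≡T[0]-T[-2] : + motzkin n ≡ + trinomial n 0ℤ - + trinomial n (- + 2)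
    motzkin≡T[0]-T[-2] = trans (cancel (+ motzkin n) (+ trinomial n (- + 2)))
                               (cong (λ t → + t - + trinomial n (- + 2)) (motzkin+trinomial[-2]≡trinomial[0] n))
      where cancel : ∀ a b → a ≡ a + b - b
            cancel = solve-∀
    rearrange : + trinomial n 0ℤ - 1ℤ - (+ trinomial n (- + 2) - -1ℤ) ≡ + motzkin n - + 2
    rearrange = trans (difference (+ trinomial n 0ℤ) (+ trinomial n (- + 2)))
                      (cong (_- + 2) (sym motzkin≡T[0]-T[-2]))
      where difference : ∀ a b → a - 1ℤ - (b - -1ℤ) ≡ a - b - (1ℤ + 1ℤ)
            difference = solve-∀

open import Data.Nat using (ℕ; suc; zero; _*_; _^_; _∸_; _≥_)
open import Data.Nat.Properties using (*-assoc; m*n≡1⇒m≡1)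
open import Data.Nat.Divisibility using (divides)
open import Data.Nat.Primality using (¬prime[1])
open import Data.Integer using (+_; _-_)
open import Data.Integer.Divisibility using (_∣_)
open import Data.Integer.Divisibility.Signed using (∣⇒∣ᵤ) renaming (_∣_ to _∣ₛ_)
open import Relation.Nullary using (contradiction)

p^[1+k]≡1+3[1+m] : ∀ {p} → Prime p → (+ 6) ∣ (+ p - + 1) → ∀ k → ∃[ m ] p ^ suc k ≡ suc (suc m * 3)
p^[1+k]≡1+3[1+m] {suc _} pr (divides a refl) k with [1+a*d]^k≡1+b*d 6 a (suc k)
... | zero  , p^[1+k]≡1 =
  contradiction (m*n≡1⇒m≡1 _ _ p^[1+k]≡1) (λ p≡1 → ¬prime[1] (subst Prime p≡1 pr))
... | suc b , p^[1+k]≡1+6[1+b] =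
  suc (b * 2) , trans p^[1+k]≡1+6[1+b] (cong suc (sym (*-assoc (suc b) 2 3)))

mainTheorem7 : (p : ℕ) → Prime p → (+ 6) ∣ (+ p - + 1) →
               (k : ℕ) → k ≥ 1 → (+ p) ∣ (+ motzkin (p ^ k ∸ 1) - + 2)
mainTheorem7 p pr 6∣p-1 (suc k) _ with p^[1+k]≡1+3[1+m] pr 6∣p-1 k
... | m , p^k≡q = ∣⇒∣ᵤ (subst (λ n → + p ∣ₛ + motzkin n - + 2) (cong (_∸ 1) (sym p^k≡q))
                              (motzkin≡2-mod (suc k) m pr (sym p^k≡q)))
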